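{- Let $\mathbb{S}$ and $\mathbb{T}$ be consistent algebraic theories and let $\mathbb{U}$ be a composite theory of $\mathbb{T}$ after $\mathbb{S}$. Then $\mathbb{U}$ is consistent.
   Context: An algebraic theory consists of a signature and a set of equations; $u =_{\mathbb{T}} v$ means provable in equational logic. A theory is consistent if it does not prove $x = y$ for two distinct variables $x,y$. $t[u_x/x]$ denotes simultaneous substitution. A theory $\mathbb{U}$ contains $\mathbb{S}$ and $\mathbb{T}$ if its signature contains both signatures and all equations of $\mathbb{S}$ and $\mathbb{T}$ are provable in $\mathbb{U}$. A $\mathbb{U}$-term is separated if it is of the form $t[s_x/x]$ with $t$ a $\mathbb{T}$-term with variables in a set $X$ and each $s_x$ ($x\in X$) an $\mathbb{S}$-term. Separated terms $t[s_x/x]$ ($t$ with variables in $X$) and $t'[s'_{x'}/x']$ ($t'$ with variables in $X'$) are equal modulo $(\mathbb{T},\mathbb{S})$ if there are a set $Y$, functions $f:X\to Y$, $f':X'\to Y$ and $\mathbb{S}$-terms $\bar s_y$ with $t[f(x)/x]=_{\mathbb T} t'[f'(x')/x']$, $s_x =_{\mathbb S}\bar s_{f(x)}$ and $s'_{x'} =_{\mathbb S}\bar s_{f'(x')}$ for all $x,x'$. $\mathbb{U}$ (containing $\mathbb{S}$ and $\mathbb{T}$) is a composite theory of $\mathbb{T}$ after $\mathbb{S}$ if every $\mathbb{U}$-term is $\mathbb{U}$-provably equal to a separated term, and any two separated terms $v,v'$ with $v =_{\mathbb U} u =_{\mathbb U} v'$ for some term $u$ are equal modulo $(\mathbb{T},\mathbb{S})$.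 -}

module Defs where

open import Data.Nat using (ℕ)
open import Data.Fin using (Fin)
open import Data.Product using (Σ; _×_; _,_; ∃)
open import Relation.Binary.PropositionalEquality using (_≡_; _≢_; subst; sym)
open import Relation.Nullary using (¬_)
open import Function.Definitions using (Injective)

record Signature : Set₁ where
  field
    Op    : Set
    arity : Op → ℕ
open Signature public

data Term (Σ' : Signature) (V : Set) : Set where
  var : V → Term Σ' V
  op  : (o : Op Σ') → (Fin (arity Σ' o) → Term Σ' V) → Term Σ' V

_[_] : ∀ {Σ' V W} → Term Σ' V → (V → Term Σ' W) → Term Σ' W
var x    [ σ ] = σ x
op o ts  [ σ ] = op o (λ i → ts i [ σ ])

record Theory : Set₁ where
  field
    sig   : Signature
    Ax    : Set
    AxVar : Ax → Set
    lhs   : (e : Ax) → Term sig (AxVar e)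
    rhs   : (e : Ax) → Term sig (AxVar e)
open Theory public

TermOf : Theory → Set → Set
TermOf 𝕋 V = Term (sig 𝕋) V

data _⊢_≈_ (𝕋 : Theory) {V : Set} : TermOf 𝕋 V → TermOf 𝕋 V → Set where
  ax    : (e : Ax 𝕋) (σ : AxVar 𝕋 e → TermOf 𝕋 V) →
          𝕋 ⊢ (lhs 𝕋 e [ σ ]) ≈ (rhs 𝕋 e [ σ ])
  refl≈ : ∀ {u} → 𝕋 ⊢ u ≈ u
  sym≈  : ∀ {u v} → 𝕋 ⊢ u ≈ v → 𝕋 ⊢ v ≈ u
  trans≈ : ∀ {u v w} → 𝕋 ⊢ u ≈ v → 𝕋 ⊢ v ≈ w → 𝕋 ⊢ u ≈ w
  cong≈ : (o : Op (sig 𝕋)) {us vs : Fin (arity (sig 𝕋) o) → TermOf 𝕋 V} →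
          (∀ i → 𝕋 ⊢ us i ≈ vs i) → 𝕋 ⊢ op o us ≈ op o vs

Consistent : Theory → Set₁
Consistent 𝕋 = ∀ {V : Set} (x y : V) → x ≢ y → ¬ (𝕋 ⊢ var x ≈ var y)

record SigIncl (Σ₁ Σ₂ : Signature) : Set where
  field
    map-op   : Op Σ₁ → Op Σ₂
    injective : Injective _≡_ _≡_ map-op
    arity-eq : ∀ o → arity Σ₂ (map-op o) ≡ arity Σ₁ o
open SigIncl public

translate : ∀ {Σ₁ Σ₂ V} → SigIncl Σ₁ Σ₂ → Term Σ₁ V → Term Σ₂ V
translate ι (var x)   = var x
translate {Σ₁} {Σ₂} ι (op o ts) =
  op (map-op ι o) (λ i → translate ι (ts (subst Fin (arity-eq ι o) i)))

record Contains (𝕌 𝕊 : Theory) : Set where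
  field
    incl     : SigIncl (sig 𝕊) (sig 𝕌)
    eqs-hold : (e : Ax 𝕊) →
               𝕌 ⊢ translate incl (lhs 𝕊 e) ≈ translate incl (rhs 𝕊 e)
open Contains public

module Composite (𝕊 𝕋 𝕌 : Theory) (cS : Contains 𝕌 𝕊) (cT : Contains 𝕌 𝕋) where

  -- Separated term  t[s_x/x]  (data presentation): t a 𝕋-term over X,
  -- s_x an 𝕊-term over V for each x ∈ X.
  record Separated (V : Set) : Set₁ where
    constructor sep
    field
      X  : Set
      t  : TermOf 𝕋 X
      s  : X → TermOf 𝕊 V

  ⟦_⟧ : ∀ {V} → Separated V → TermOf 𝕌 V
  ⟦ sep X t s ⟧ = translate (incl cT) t [ (λ x → translate (incl cS) (s x)) ]

  EqualMod : ∀ {V} → Separated V → Separated V → Set₁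
  EqualMod {V} (sep X t s) (sep X' t' s') =
    Σ Set λ Y → Σ (X → Y) λ f → Σ (X' → Y) λ f' → Σ (Y → TermOf 𝕊 V) λ s̄ →
      (𝕋 ⊢ (t [ (λ x → var (f x)) ]) ≈ (t' [ (λ x' → var (f' x')) ]))
      × (∀ x → 𝕊 ⊢ s x ≈ s̄ (f x))
      × (∀ x' → 𝕊 ⊢ s' x' ≈ s̄ (f' x'))

  record IsComposite : Set₂ where
    field
      separation : ∀ {V : Set} (u : TermOf 𝕌 V) →
                   Σ (Separated V) λ v → 𝕌 ⊢ u ≈ ⟦ v ⟧
      uniqueness : ∀ {V : Set} (v v' : Separated V) (u : TermOf 𝕌 V) →
                   𝕌 ⊢ ⟦ v ⟧ ≈ u → 𝕌 ⊢ u ≈ ⟦ v' ⟧ → EqualMod v v'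

record CompositeTheory (𝕋 𝕊 𝕌 : Theory) : Set₂ where
  field
    containsS : Contains 𝕌 𝕊
    containsT : Contains 𝕌 𝕋
    isComposite : Composite.IsComposite 𝕊 𝕋 𝕌 containsS containsT

-- A variable x is separated as the 𝕋-variable ∗ with ∗ substituted by the
-- 𝕊-term x. If 𝕌 proved x = y for distinct x, y, uniqueness of separated
-- forms would give 𝕋 ⊢ f ∗ = f' ∗ together with 𝕊 ⊢ x = s̄ (f ∗) and
-- 𝕊 ⊢ y = s̄ (f' ∗): consistency of 𝕋 forces f ∗ ≡ f' ∗, and then 𝕊 proves x = y.
module Submission where

open import Defs
open import Data.Unit using (⊤; tt)
open import Data.Product using (_,_)
open import Relation.Binary.PropositionalEquality using (_≡_; _≢_; refl; cong)
open import Relation.Nullary using (¬_)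

≡⇒⊢≈ : ∀ {𝕋 V} {u v : TermOf 𝕋 V} → u ≡ v → 𝕋 ⊢ u ≈ v
≡⇒⊢≈ refl = refl≈

module _ (𝕊 𝕋 𝕌 : Theory) (cS : Contains 𝕌 𝕊) (cT : Contains 𝕌 𝕋) where
  open Composite 𝕊 𝕋 𝕌 cS cT

  -- ⟦ varSeparated x ⟧ reduces to var x.
  varSeparated : ∀ {V} → V → Separated V
  varSeparated x = sep ⊤ (var tt) (λ _ → var x)

  distinct-varSeparated-not-EqualMod :
    Consistent 𝕊 → Consistent 𝕋 → ∀ {V} {x y : V} → x ≢ y →
    ¬ EqualMod (varSeparated x) (varSeparated y)
  distinct-varSeparated-not-EqualMod conS conT {x = x} {y} x≢y
    (Y , f , f' , s̄ , f≈f' , x≈s̄f , y≈s̄f') = conT (f tt) (f' tt) f≢f' f≈f'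
    where
    f≢f' : f tt ≢ f' tt
    f≢f' f≡f' = conS x y x≢y
      (trans≈ (x≈s̄f tt) (trans≈ (≡⇒⊢≈ (cong s̄ f≡f')) (sym≈ (y≈s̄f' tt))))

proposition2p21 : (𝕊 𝕋 𝕌 : Theory) → Consistent 𝕊 → Consistent 𝕋 →
                  CompositeTheory 𝕋 𝕊 𝕌 → Consistent 𝕌
proposition2p21 𝕊 𝕋 𝕌 conS conT composite x y x≢y x≈y =
  distinct-varSeparated-not-EqualMod 𝕊 𝕋 𝕌 containsS containsT conS conT x≢y
    (uniqueness (varSeparated 𝕊 𝕋 𝕌 containsS containsT x)
                (varSeparated 𝕊 𝕋 𝕌 containsS containsT y)
                (var x) refl≈ x≈y)
  where
  open CompositeTheory composite
  open Composite.IsComposite isComposite
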